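{- Every finite simple undirected graph $G$ is the intersection graph of some exactly hittable hypergraph. Further, if $G$ is a connected chordal graph, then $G$ is the intersection graph of an exactly hittable family of subtrees of a tree.
   Context: A hypergraph $H=(\mathcal{V},\mathcal{E})$ is exactly hittable if there exists $T\subseteq\mathcal{V}$ with $|T\cap E|=1$ for every hyperedge $E\in\mathcal{E}$. The intersection graph of a family of sets $\{S_v\}_{v}$ has a vertex for each set and an edge between two distinct vertices iff the corresponding sets intersect. A family of subtrees $\{T_v\}$ of a tree is exactly hittable if there is a set $X$ of tree nodes with $|X\cap V(T_v)|=1$ for every $v$. A chordal graph is a graph with no induced cycle of length at least 4. -}

module Defs where

open import Data.Nat using (ℕ; zero; suc; _≤_)
open import Data.Fin using (Fin; toℕ)
open import Data.Bool using (Bool; true; false)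
open import Data.Product using (Σ; ∃; _×_; _,_)
open import Data.Sum using (_⊎_)
open import Data.Unit using (⊤)
open import Relation.Nullary using (¬_)
open import Relation.Binary.PropositionalEquality using (_≡_; _≢_)
open import Function.Definitions using (Injective)

record SimpleGraph (n : ℕ) : Set where
  field
    adj    : Fin n → Fin n → Bool
    sym    : ∀ u v → adj u v ≡ adj v u
    irrefl : ∀ v → adj v v ≡ false
open SimpleGraph public

Adj : ∀ {n} → SimpleGraph n → Fin n → Fin n → Set
Adj G u v = adj G u v ≡ true

data ReachIn {n : ℕ} (G : SimpleGraph n) (P : Fin n → Set) : Fin n → Fin n → Set where
  here : ∀ {x} → P x → ReachIn G P x x
  step : ∀ {x y z} → ReachIn G P x y → Adj G y z → P z → ReachIn G P x z

Connected : ∀ {n} → SimpleGraph n → Set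
Connected {n} G = ∀ (u v : Fin n) → ReachIn G (λ _ → ⊤) u v

CycSucc : (k : ℕ) → Fin k → Fin k → Set
CycSucc k i j = (suc (toℕ i) ≡ toℕ j) ⊎ ((suc (toℕ i) ≡ k) × (toℕ j ≡ 0))

IsCycle : ∀ {n} → SimpleGraph n → (k : ℕ) → (Fin k → Fin n) → Set
IsCycle G k c = (3 ≤ k) × Injective _≡_ _≡_ c
              × (∀ i j → CycSucc k i j → Adj G (c i) (c j))

IsInducedCycle : ∀ {n} → SimpleGraph n → (k : ℕ) → (Fin k → Fin n) → Set
IsInducedCycle G k c = Injective _≡_ _≡_ c
  × (∀ i j → (Adj G (c i) (c j) → CycSucc k i j ⊎ CycSucc k j i)
           × (CycSucc k i j ⊎ CycSucc k j i → Adj G (c i) (c j)))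

Chordal : ∀ {n} → SimpleGraph n → Set
Chordal {n} G = ∀ (k : ℕ) (c : Fin k → Fin n) → 4 ≤ k → ¬ IsInducedCycle G k c

IsTree : ∀ {m} → SimpleGraph m → Set
IsTree {m} T = (1 ≤ m) × Connected T
             × (∀ (k : ℕ) (c : Fin k → Fin m) → ¬ IsCycle T k c)

_∈ₛ_ : ∀ {m} → Fin m → (Fin m → Bool) → Set
x ∈ₛ S = S x ≡ true

IsSubtree : ∀ {m} → SimpleGraph m → (Fin m → Bool) → Set
IsSubtree T S = (∃ λ x → x ∈ₛ S)
              × (∀ x y → x ∈ₛ S → y ∈ₛ S → ReachIn T (λ z → z ∈ₛ S) x y)

IsIntersectionGraphOf : ∀ {n m} → SimpleGraph n → (Fin n → Fin m → Bool) → Set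
IsIntersectionGraphOf {n} G S =
  ∀ (u v : Fin n) → u ≢ v →
    (Adj G u v → ∃ λ x → x ∈ₛ S u × x ∈ₛ S v)
    × ((∃ λ x → x ∈ₛ S u × x ∈ₛ S v) → Adj G u v)

ExactlyHittable : ∀ {n m} → (Fin n → Fin m → Bool) → Set
ExactlyHittable {n} {m} S =
  Σ (Fin m → Bool) λ X → ∀ (v : Fin n) →
    (∃ λ x → x ∈ₛ X × x ∈ₛ S v)
    × (∀ x y → x ∈ₛ X → x ∈ₛ S v → y ∈ₛ X → y ∈ₛ S v → x ≡ y)

HasExactlyHittableHypergraphRep : ∀ {n} → SimpleGraph n → Set
HasExactlyHittableHypergraphRep {n} G =
  Σ ℕ λ m → Σ (Fin n → Fin m → Bool) λ S →
    (∀ u v → (∀ x → S u x ≡ S v x) → u ≡ v)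
    × IsIntersectionGraphOf G S × ExactlyHittable S

HasExactlyHittableSubtreeRep : ∀ {n} → SimpleGraph n → Set
HasExactlyHittableSubtreeRep {n} G =
  Σ ℕ λ m → Σ (SimpleGraph m) λ T → Σ (Fin n → Fin m → Bool) λ S →
    IsTree T × (∀ v → IsSubtree T (S v))
    × IsIntersectionGraphOf G S × ExactlyHittable S

-- Give each vertex v the hyperedge consisting of its private loop (v , v)
-- and of the edges at v, read as ordered pairs.  Two such hyperedges can only share an
-- edge joining their vertices, and the loops meet every hyperedge exactly once.
--
-- A chordal graph has a simplicial vertex (Dirac): if a and b are not adjacent,
-- the boundary of the component of b in U ∖ N[a] is a clique, since a shortest path
-- through the component closes with a into an induced cycle of length at least 4
-- otherwise; induction on that component and its boundary, and then on the component of
-- a beyond it, gives two non-adjacent simplicial vertices.  Remove a simplicial vertex v,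
-- represent the rest, and keep the Helly property, so that some node h lies in the
-- subtrees of all neighbours of v.  Hang a new node below h, shared by v and its
-- neighbours, and below it a private leaf of v; only the leaf joins the hitting set.

{-# OPTIONS --safe #-}
module Submission where

open import Defs renaming (sym to adj-sym)
open import Data.Bool using (Bool; true; if_then_else_) renaming (_≟_ to _≟ᵇ_)
open import Data.Empty using (⊥; ⊥-elim)
open import Data.Fin using (Fin; toℕ; fromℕ; fromℕ<; inject₁; combine; remQuot; _≟_)
  renaming (zero to fzero; suc to fsuc)
open import Data.Fin.Properties
  using (any?; remQuot-combine; combine-remQuot; toℕ<n; toℕ-injective; toℕ-fromℕ; toℕ-fromℕ<;
         toℕ-inject₁; nonZeroIndex)
open import Data.List using (allFin)
open import Data.List.Extrema.Nat using (argmax; f[xs]≤f[argmax])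
open import Data.List.Membership.Propositional.Properties using (∈-allFin)
import Data.List.Relation.Unary.All as All
open import Data.Nat using (ℕ; zero; suc; _+_; _*_; _∸_; _≤_; _<_; _>_; z≤n; s≤s; >-nonZero⁻¹)
import Data.Nat as ℕ
open import Data.Nat.Induction using (<-wellFounded)
open import Data.Nat.Properties
  using (≤-refl; ≤-antisym; ≤-pred; <-trans; <-≤-trans; ≤-<-trans; <-irrefl; <-cmp; <⇒≤; <⇒≱;
         ≮⇒≥; ≤∧≢⇒<; 1+n≰n; m<n⇒m<1+n; m≤n⇒m<n∨m≡n; n≢0⇒n>0; suc-injective; +-identityʳ;
         +-mono-≤; +-mono-≤-<; +-mono-<-≤; +-monoˡ-<; m≤m+n; m<m+n; m+n≤o⇒n≤o; m+n≤o⇒m≤o∸n;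
         m∸n+n≡m; m≤n⇒∃[o]m+o≡n)
open import Data.Product using (∃; ∃₂; _×_; _,_; proj₁; proj₂; uncurry; map₂)
open import Data.Sum using (_⊎_; inj₁; inj₂; [_,_]; swap)
open import Data.Unit using (⊤; tt)
open import Function using (_∘_)
open import Function.Bundles using (mk⇔)
open import Induction.WellFounded using (Acc; acc)
open import Level using (0ℓ)
open import Relation.Binary using (tri<; tri≈; tri>)
open import Relation.Binary.PropositionalEquality
  using (_≡_; _≢_; ≢-sym; refl; sym; trans; cong; subst; subst₂)
open import Relation.Nullary using (¬_; Dec; yes; no; does; contradiction)
open import Relation.Nullary.Decidable
  using (dec-true; dec-false; does-⇔; decidable-stable; ¬?; _×-dec_; _⊎-dec_)
open import Relation.Unary using (Pred; Decidable)

private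
  variable
    n : ℕ

dec-true⁻ : {A : Set} (a? : Dec A) → does a? ≡ true → A
dec-true⁻ (yes a) _ = a

module _ {A : Set} where

  _◁_ : A → (ℕ → A) → ℕ → A
  (x ◁ p) zero = x
  (x ◁ p) (suc k) = p k

  snoc : ℕ → (ℕ → A) → A → ℕ → A
  snoc l p z k with k ℕ.≤? l
  ... | yes _ = p k
  ... | no _ = z

  snoc-≤ : ∀ l p z {k} → k ≤ l → snoc l p z k ≡ p k
  snoc-≤ l p z {k} k≤l with k ℕ.≤? l
  ... | yes _ = refl
  ... | no k≰l = contradiction k≤l k≰l

  snoc-suc : ∀ l p z → snoc l p z (suc l) ≡ z
  snoc-suc l p z with suc l ℕ.≤? l
  ... | yes 1+l≤l = contradiction 1+l≤l 1+n≰n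
  ... | no _ = refl

record DecSubset (n : ℕ) : Set₁ where
  field
    Member  : Pred (Fin n) 0ℓ
    member? : Decidable Member
open DecSubset

infix 4 _∈_ _∉_ _∈?_ _⊆_
infixl 25 _∖_
infixl 24 _∪_

_∈_ : Fin n → DecSubset n → Set
x ∈ S = Member S x

_∉_ : Fin n → DecSubset n → Set
x ∉ S = ¬ x ∈ S

_∈?_ : (x : Fin n) (S : DecSubset n) → Dec (x ∈ S)
x ∈? S = member? S x

_⊆_ : DecSubset n → DecSubset n → Set
P ⊆ Q = ∀ {x} → x ∈ P → x ∈ Q

∅ : DecSubset n
∅ = record { Member = λ _ → ⊥ ; member? = λ _ → no λ () }

｛_｝ : Fin n → DecSubset n
｛ b ｝ = record { Member = _≡ b ; member? = _≟ b }

insert : Fin n → DecSubset n → DecSubset n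
insert z P = record { Member = λ x → x ≡ z ⊎ x ∈ P ; member? = λ x → x ≟ z ⊎-dec x ∈? P }

_∪_ : DecSubset n → DecSubset n → DecSubset n
P ∪ Q = record { Member = λ x → x ∈ P ⊎ x ∈ Q ; member? = λ x → x ∈? P ⊎-dec x ∈? Q }

_∖_ : DecSubset n → DecSubset n → DecSubset n
P ∖ Q = record { Member = λ x → x ∈ P × x ∉ Q ; member? = λ x → x ∈? P ×-dec ¬? (x ∈? Q) }

private
  tail : DecSubset (suc n) → DecSubset n
  tail S = record { Member = Member S ∘ fsuc ; member? = member? S ∘ fsuc }

  indicator : {A : Set} → Dec A → ℕ
  indicator a? = if does a? then 1 else 0

  indicator-mono : {A B : Set} (a? : Dec A) (b? : Dec B) → (A → B) → indicator a? ≤ indicator b?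
  indicator-mono (no _) _ _ = z≤n
  indicator-mono (yes _) (yes _) _ = ≤-refl
  indicator-mono (yes a) (no ¬b) a⇒b = contradiction (a⇒b a) ¬b

  indicator-mono-< : {A B : Set} (a? : Dec A) (b? : Dec B) → ¬ A → B → indicator a? < indicator b?
  indicator-mono-< (yes a) _ ¬a _ = contradiction a ¬a
  indicator-mono-< (no _) (yes _) _ _ = s≤s z≤n
  indicator-mono-< (no _) (no ¬b) _ b = contradiction b ¬b

∣_∣ : DecSubset n → ℕ
∣_∣ {zero}  S = 0
∣_∣ {suc n} S = indicator (fzero ∈? S) + ∣ tail S ∣

p⊆q⇒∣p∣≤∣q∣ : (P Q : DecSubset n) → P ⊆ Q → ∣ P ∣ ≤ ∣ Q ∣
p⊆q⇒∣p∣≤∣q∣ {zero} P Q P⊆Q = z≤n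
p⊆q⇒∣p∣≤∣q∣ {suc n} P Q P⊆Q =
  +-mono-≤ (indicator-mono (fzero ∈? P) (fzero ∈? Q) P⊆Q) (p⊆q⇒∣p∣≤∣q∣ (tail P) (tail Q) P⊆Q)

p⊂q⇒∣p∣<∣q∣ : (P Q : DecSubset n) {x : Fin n} → P ⊆ Q → x ∈ Q → x ∉ P → ∣ P ∣ < ∣ Q ∣
p⊂q⇒∣p∣<∣q∣ {suc n} P Q {fzero} P⊆Q x∈Q x∉P =
  +-mono-<-≤ (indicator-mono-< (fzero ∈? P) (fzero ∈? Q) x∉P x∈Q)
             (p⊆q⇒∣p∣≤∣q∣ (tail P) (tail Q) P⊆Q)
p⊂q⇒∣p∣<∣q∣ {suc n} P Q {fsuc x} P⊆Q x∈Q x∉P =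
  +-mono-≤-< (indicator-mono (fzero ∈? P) (fzero ∈? Q) P⊆Q)
             (p⊂q⇒∣p∣<∣q∣ (tail P) (tail Q) P⊆Q x∈Q x∉P)

module GraphNotions (G : SimpleGraph n) where

  Adj? : ∀ u v → Dec (Adj G u v)
  Adj? u v = adj G u v ≟ᵇ true

  Adj-sym : ∀ {u v} → Adj G u v → Adj G v u
  Adj-sym {u} {v} = trans (adj-sym G v u)

  Adj⇒≢ : ∀ {u v} → Adj G u v → u ≢ v
  Adj⇒≢ {u} uv refl = contradiction (trans (sym uv) (irrefl G u)) λ ()

  N[_] : Fin n → DecSubset n
  N[ a ] = record { Member = λ v → v ≡ a ⊎ Adj G a v ; member? = λ v → v ≟ a ⊎-dec Adj? a v }

  boundary : DecSubset n → DecSubset n → DecSubset n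
  boundary U C = record
    { Member  = λ z → z ∈ U × z ∉ C × ∃ λ c → c ∈ C × Adj G z c
    ; member? = λ z → z ∈? U ×-dec ¬? (z ∈? C) ×-dec any? (λ c → c ∈? C ×-dec Adj? z c) }

  IsClique : DecSubset n → Set
  IsClique K = ∀ {u w} → u ∈ K → w ∈ K → u ≢ w → Adj G u w

  IsSimplicial : DecSubset n → Fin n → Set
  IsSimplicial U v = v ∈ U × ∀ {x y} → x ∈ U → y ∈ U → Adj G v x → Adj G v y → x ≢ y → Adj G x y

module IncidenceHypergraph (G : SimpleGraph n) where
  open GraphNotions G

  Incident : Fin n → Fin n × Fin n → Set
  Incident v (u , w) = (u ≡ v ⊎ w ≡ v) × (u ≡ w ⊎ Adj G u w)

  incident? : ∀ v p → Dec (Incident v p)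
  incident? v (u , w) = (u ≟ v ⊎-dec w ≟ v) ×-dec (u ≟ w ⊎-dec Adj? u w)

  incident-loop : ∀ {v u} → Incident v (u , u) → u ≡ v
  incident-loop (inj₁ u≡v , _) = u≡v
  incident-loop (inj₂ u≡v , _) = u≡v

  common-incident⇒Adj : ∀ {v₁ v₂ p} → v₁ ≢ v₂ → Incident v₁ p → Incident v₂ p → Adj G v₁ v₂
  common-incident⇒Adj v₁≢v₂ (inj₁ refl , _) (inj₁ refl , _) = contradiction refl v₁≢v₂
  common-incident⇒Adj v₁≢v₂ (inj₂ refl , _) (inj₂ refl , _) = contradiction refl v₁≢v₂
  common-incident⇒Adj v₁≢v₂ (inj₁ refl , inj₁ refl) (inj₂ refl , _) = contradiction refl v₁≢v₂
  common-incident⇒Adj v₁≢v₂ (inj₁ refl , inj₂ uw) (inj₂ refl , _) = uw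
  common-incident⇒Adj v₁≢v₂ (inj₂ refl , inj₁ refl) (inj₁ refl , _) = contradiction refl v₁≢v₂
  common-incident⇒Adj v₁≢v₂ (inj₂ refl , inj₂ uw) (inj₁ refl , _) = Adj-sym uw

  pair : Fin (n * n) → Fin n × Fin n
  pair = remQuot n

  pair-injective : ∀ {x y} → pair x ≡ pair y → x ≡ y
  pair-injective {x} {y} eq =
    trans (sym (combine-remQuot {n} n x)) (trans (cong (uncurry combine) eq) (combine-remQuot {n} n y))

  hyperedge : Fin n → Fin (n * n) → Bool
  hyperedge v x = does (incident? v (pair x))

  ∈-hyperedge⁺ : ∀ {v x} → Incident v (pair x) → x ∈ₛ hyperedge v
  ∈-hyperedge⁺ {v} {x} = dec-true (incident? v (pair x))

  ∈-hyperedge⁻ : ∀ {v x} → x ∈ₛ hyperedge v → Incident v (pair x)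
  ∈-hyperedge⁻ {v} {x} = dec-true⁻ (incident? v (pair x))

  loops : Fin (n * n) → Bool
  loops x = does (uncurry _≟_ (pair x))

  loop : Fin n → Fin (n * n)
  loop v = combine v v

  pair-loop : ∀ v → pair (loop v) ≡ (v , v)
  pair-loop v = remQuot-combine v v

  loop∈loops : ∀ v → loop v ∈ₛ loops
  loop∈loops v = dec-true (uncurry _≟_ (pair (loop v))) (subst (uncurry _≡_) (sym (pair-loop v)) refl)

  loop∈hyperedge : ∀ v → loop v ∈ₛ hyperedge v
  loop∈hyperedge v = ∈-hyperedge⁺ (subst (Incident v) (sym (pair-loop v)) (inj₁ refl , inj₁ refl))

  incident-diagonal : ∀ {v} p → uncurry _≡_ p → Incident v p → p ≡ (v , v)
  incident-diagonal (u , .u) refl incident rewrite incident-loop incident = refl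

  loop-unique : ∀ {v x} → x ∈ₛ loops → x ∈ₛ hyperedge v → pair x ≡ (v , v)
  loop-unique {v} {x} x∈loops x∈v =
    incident-diagonal (pair x) (dec-true⁻ (uncurry _≟_ (pair x)) x∈loops) (∈-hyperedge⁻ x∈v)

  hypergraphRep : HasExactlyHittableHypergraphRep G
  hypergraphRep = n * n , hyperedge , injective , intersection , loops , hit
    where
    injective : ∀ u v → (∀ x → hyperedge u x ≡ hyperedge v x) → u ≡ v
    injective u v same = incident-loop (subst (Incident v) (pair-loop u)
      (∈-hyperedge⁻ (trans (sym (same (loop u))) (loop∈hyperedge u))))

    intersection : IsIntersectionGraphOf G hyperedge
    intersection u v u≢v = shared , shared⇒Adj
      where
      edge : ∀ {w} → Incident w (u , v) → Incident w (pair (combine u v))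
      edge = subst (Incident _) (sym (remQuot-combine u v))
      shared : Adj G u v → ∃ λ x → x ∈ₛ hyperedge u × x ∈ₛ hyperedge v
      shared uv = combine u v , ∈-hyperedge⁺ (edge (inj₁ refl , inj₂ uv))
                              , ∈-hyperedge⁺ (edge (inj₂ refl , inj₂ uv))
      shared⇒Adj : (∃ λ x → x ∈ₛ hyperedge u × x ∈ₛ hyperedge v) → Adj G u v
      shared⇒Adj (x , x∈u , x∈v) = common-incident⇒Adj u≢v (∈-hyperedge⁻ x∈u) (∈-hyperedge⁻ x∈v)

    hit : ∀ v → (∃ λ x → x ∈ₛ loops × x ∈ₛ hyperedge v)
              × (∀ x y → x ∈ₛ loops → x ∈ₛ hyperedge v
                       → y ∈ₛ loops → y ∈ₛ hyperedge v → x ≡ y)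
    hit v = (loop v , loop∈loops v , loop∈hyperedge v)
          , λ x y x∈loops x∈v y∈loops y∈v →
              pair-injective (trans (loop-unique x∈loops x∈v) (sym (loop-unique y∈loops y∈v)))

module Reachability (G : SimpleGraph n) {P : Pred (Fin n) 0ℓ} where
  open GraphNotions G

  reach-target : ∀ {x y} → ReachIn G P x y → P y
  reach-target (here px) = px
  reach-target (step _ _ pz) = pz

  reach-trans : ∀ {x y z} → ReachIn G P x y → ReachIn G P y z → ReachIn G P x z
  reach-trans r (here _) = r
  reach-trans r (step s yz pz) = step (reach-trans r s) yz pz

  reach-sym : ∀ {x y} → ReachIn G P x y → ReachIn G P y x
  reach-sym (here px) = here px
  reach-sym (step r yz pz) = reach-trans (step (here pz) (Adj-sym yz) (reach-target r)) (reach-sym r)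

  reach-mono : ∀ {Q : Pred (Fin n) 0ℓ} → (∀ {x} → P x → Q x)
             → ∀ {x y} → ReachIn G P x y → ReachIn G Q x y
  reach-mono P⇒Q (here px) = here (P⇒Q px)
  reach-mono P⇒Q (step r yz pz) = step (reach-mono P⇒Q r) yz (P⇒Q pz)

module _ (G : SimpleGraph n) where
  open GraphNotions G

  record Walk (P : Pred (Fin n) 0ℓ) (x y : Fin n) : Set where
    field
      length : ℕ
      vertex : ℕ → Fin n
      start  : vertex 0 ≡ x
      end    : vertex length ≡ y
      steps  : ∀ {k} → k < length → Adj G (vertex k) (vertex (suc k))
      inside : ∀ {k} → k ≤ length → P (vertex k)

  reach⇒walk : ∀ {P x y} → ReachIn G P x y → Walk P x y
  reach⇒walk {x = x} (here px) = record
    { length = 0 ; vertex = λ _ → x ; start = refl ; end = refl ; steps = λ () ; inside = λ _ → px }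
  reach⇒walk {P} (step {z = z} r yz pz) = record
    { length = suc m ; vertex = snoc m vertex z ; start = trans (snoc-≤ m vertex z z≤n) start
    ; end = snoc-suc m vertex z ; steps = steps′ ; inside = inside′ }
    where
    open Walk (reach⇒walk r)
    m = length
    steps′ : ∀ {k} → k < suc m → Adj G (snoc m vertex z k) (snoc m vertex z (suc k))
    steps′ {k} k<1+m with m≤n⇒m<n∨m≡n (≤-pred k<1+m)
    ... | inj₁ k<m =
      subst₂ (Adj G) (sym (snoc-≤ m vertex z (<⇒≤ k<m))) (sym (snoc-≤ m vertex z k<m)) (steps k<m)
    ... | inj₂ refl = subst₂ (Adj G) (sym (trans (snoc-≤ m vertex z ≤-refl) end)) (sym (snoc-suc m vertex z)) yz
    inside′ : ∀ {k} → k ≤ suc m → P (snoc m vertex z k)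
    inside′ {k} k≤1+m with m≤n⇒m<n∨m≡n k≤1+m
    ... | inj₁ k<1+m = subst P (sym (snoc-≤ m vertex z (≤-pred k<1+m))) (inside (≤-pred k<1+m))
    ... | inj₂ refl = subst P (sym (snoc-suc m vertex z)) pz

module _ (G : SimpleGraph n) where
  open GraphNotions G
  open Reachability G

  record Component (P : DecSubset n) (b : Fin n) : Set₁ where
    field
      members   : DecSubset n
      ⊆P        : members ⊆ P
      b∈        : b ∈ members
      connected : ∀ {z} → z ∈ members → ReachIn G (_∈ members) b z
      closed    : ∀ {y z} → y ∈ members → z ∈ P → Adj G y z → z ∈ members

  private
    grow : ∀ P b (C : DecSubset n) → C ⊆ P → b ∈ C → (∀ {z} → z ∈ C → ReachIn G (_∈ C) b z)
         → Acc _<_ ∣ P ∖ C ∣ → Component P b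
    grow P b C C⊆P b∈C reach (acc smaller)
      with any? (λ y → any? (λ z → y ∈? C ×-dec z ∈? P ∖ C ×-dec Adj? y z))
    ... | no stuck = record { members = C ; ⊆P = C⊆P ; b∈ = b∈C ; connected = reach ; closed = closed }
      where
      closed : ∀ {y z} → y ∈ C → z ∈ P → Adj G y z → z ∈ C
      closed {y} {z} y∈C z∈P yz with z ∈? C
      ... | yes z∈C = z∈C
      ... | no z∉C = contradiction (y , z , y∈C , (z∈P , z∉C) , yz) stuck
    ... | yes (y , z , y∈C , (z∈P , z∉C) , yz) =
      grow P b C′ C′⊆P (inj₂ b∈C) reach′
           (smaller (p⊂q⇒∣p∣<∣q∣ (P ∖ C′) (P ∖ C) shrink (z∈P , z∉C) z∉P∖C′))
      where
      C′ = insert z C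
      C′⊆P : C′ ⊆ P
      C′⊆P (inj₁ refl) = z∈P
      C′⊆P (inj₂ x∈C) = C⊆P x∈C
      reach′ : ∀ {x} → x ∈ C′ → ReachIn G (_∈ C′) b x
      reach′ (inj₁ refl) = step (reach-mono inj₂ (reach y∈C)) yz (inj₁ refl)
      reach′ (inj₂ x∈C) = reach-mono inj₂ (reach x∈C)
      shrink : P ∖ C′ ⊆ P ∖ C
      shrink (x∈P , x∉C′) = x∈P , x∉C′ ∘ inj₂
      z∉P∖C′ : z ∉ P ∖ C′
      z∉P∖C′ (_ , z∉C′) = z∉C′ (inj₁ refl)

  component : ∀ {P b} → b ∈ P → Component P b
  component {P} {b} b∈P = grow P b ｛ b ｝ (λ { refl → b∈P }) refl (λ { refl → here refl }) (<-wellFounded _)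

cycSucc? : ∀ k (i j : Fin k) → Dec (CycSucc k i j)
cycSucc? k i j = (suc (toℕ i) ℕ.≟ toℕ j) ⊎-dec ((suc (toℕ i) ℕ.≟ k) ×-dec (toℕ j ℕ.≟ 0))

cycSucc-exists : ∀ {k} (i : Fin k) → ∃ (CycSucc k i)
cycSucc-exists {suc k} i with suc (toℕ i) ℕ.<? suc k
... | yes 1+i<k = fromℕ< 1+i<k , inj₁ (sym (toℕ-fromℕ< 1+i<k))
... | no 1+i≮k = fzero , inj₂ (≤-antisym (toℕ<n i) (≮⇒≥ 1+i≮k) , refl)

cycPred-exists : ∀ {k} (i : Fin k) → ∃ λ h → CycSucc k h i
cycPred-exists {suc k} fzero = fromℕ k , inj₂ (cong suc (toℕ-fromℕ k) , refl)
cycPred-exists {suc k} (fsuc i) = inject₁ i , inj₁ (cong suc (toℕ-inject₁ i))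

private
  cycSuccℕ²-≢ : ∀ k x y z → 3 ≤ k
              → suc x ≡ y ⊎ (suc x ≡ k × y ≡ 0) → suc y ≡ z ⊎ (suc y ≡ k × z ≡ 0) → x ≢ z
  cycSuccℕ²-≢ k x y z 3≤k (inj₁ refl) (inj₁ refl) ()
  cycSuccℕ²-≢ k x y z (s≤s (s≤s ())) (inj₁ refl) (inj₂ (refl , refl)) refl
  cycSuccℕ²-≢ k x y z (s≤s (s≤s ())) (inj₂ (refl , refl)) (inj₁ refl) refl

cycSucc²-≢ : ∀ {k} {h i j : Fin k} → 3 ≤ k → CycSucc k h i → CycSucc k i j → h ≢ j
cycSucc²-≢ {k} {h} {i} {j} 3≤k hi ij = cycSuccℕ²-≢ k (toℕ h) (toℕ i) (toℕ j) 3≤k hi ij ∘ cong toℕ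

module _ (G : SimpleGraph n) (chordal : Chordal G) where
  open GraphNotions G

  chord-or-repeat : ∀ {k} (c : Fin k → Fin n) → 4 ≤ k → (∀ i j → CycSucc k i j → Adj G (c i) (c j))
    → (∃₂ λ i j → i ≢ j × c i ≡ c j)
      ⊎ (∃₂ λ i j → Adj G (c i) (c j) × ¬ CycSucc k i j × ¬ CycSucc k j i)
  chord-or-repeat {k} c 4≤k cycle
    with any? (λ i → any? (λ j → ¬? (i ≟ j) ×-dec c i ≟ c j))
       | any? (λ i → any? (λ j → Adj? (c i) (c j) ×-dec ¬? (cycSucc? k i j) ×-dec ¬? (cycSucc? k j i)))
  ... | yes repeat | _ = inj₁ repeat
  ... | no _ | yes chord = inj₂ chord
  ... | no noRepeat | no noChord = ⊥-elim (chordal k c 4≤k (injective , λ i j → chordless i j , consecutive i j))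
    where
    injective : ∀ {i j} → c i ≡ c j → i ≡ j
    injective {i} {j} cᵢ≡cⱼ with i ≟ j
    ... | yes i≡j = i≡j
    ... | no i≢j = contradiction (i , j , i≢j , cᵢ≡cⱼ) noRepeat
    chordless : ∀ i j → Adj G (c i) (c j) → CycSucc k i j ⊎ CycSucc k j i
    chordless i j cᵢcⱼ with cycSucc? k i j | cycSucc? k j i
    ... | yes ij | _ = inj₁ ij
    ... | no _ | yes ji = inj₂ ji
    ... | no ¬ij | no ¬ji = contradiction (i , j , cᵢcⱼ , ¬ij , ¬ji) noChord
    consecutive : ∀ i j → CycSucc k i j ⊎ CycSucc k j i → Adj G (c i) (c j)
    consecutive i j (inj₁ ij) = cycle i j ij
    consecutive i j (inj₂ ji) = Adj-sym (cycle j i ji)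

module _ (G : SimpleGraph n) (a : Fin n) where
  open GraphNotions G

  record Detour (l : ℕ) (p : ℕ → Fin n) : Set where
    field
      steps : ∀ {k} → k < l → Adj G (p k) (p (suc k))
      first : Adj G a (p 0)
      last  : Adj G a (p l)
      inner : ∀ {k} → 0 < k → k < l → p k ∉ N[ a ]

module DetourLemma (G : SimpleGraph n) (chordal : Chordal G) (a : Fin n) where
  open GraphNotions G
  open Detour

  Closes : ℕ → Set
  Closes l = ∀ p → Detour G a l p → p l ∈ N[ p 0 ]

  skip : ℕ → ℕ → (ℕ → Fin n) → ℕ → Fin n
  skip X e p k with k ℕ.≤? X
  ... | yes _ = p k
  ... | no _ = p (k + e)

  skip-≤ : ∀ {X e p k} → k ≤ X → skip X e p k ≡ p k
  skip-≤ {X} {k = k} k≤X with k ℕ.≤? X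
  ... | yes _ = refl
  ... | no k≰X = contradiction k≤X k≰X

  skip-> : ∀ {X e p k} → X < k → skip X e p k ≡ p (k + e)
  skip-> {X} {k = k} X<k with k ℕ.≤? X
  ... | yes k≤X = contradiction k≤X (<⇒≱ X<k)
  ... | no _ = refl

  shortcut : ∀ {l′ e X p} → Detour G a (l′ + e) p → X < l′ → Adj G (p X) (p (suc X + e))
           → ∃ λ q → Detour G a l′ q × q 0 ≡ p 0 × q l′ ≡ p (l′ + e)
  shortcut {l′} {e} {X} {p} w X<l′ chord = q , detour , before z≤n , after X<l′
    where
    q = skip X e p
    before : ∀ {k} → k ≤ X → q k ≡ p k
    before = skip-≤ {X} {e} {p}
    after : ∀ {k} → X < k → q k ≡ p (k + e)
    after = skip-> {X} {e} {p}
    X<L : X < l′ + e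
    X<L = <-≤-trans X<l′ (m≤m+n l′ e)
    detour : Detour G a l′ q
    detour .steps {k} k<l′ with <-cmp k X
    ... | tri< k<X _ _ = subst₂ (Adj G) (sym (before (<⇒≤ k<X))) (sym (before k<X)) (steps w (<-trans k<X X<L))
    ... | tri≈ _ refl _ = subst₂ (Adj G) (sym (before ≤-refl)) (sym (after ≤-refl)) chord
    ... | tri> _ _ X<k = subst₂ (Adj G) (sym (after X<k)) (sym (after (m<n⇒m<1+n X<k))) (steps w (+-monoˡ-< e k<l′))
    detour .first = subst (Adj G a) (sym (before z≤n)) (first w)
    detour .last = subst (Adj G a) (sym (after X<l′)) (last w)
    detour .inner {k} 0<k k<l′ with k ℕ.≤? X
    ... | yes k≤X = inner w 0<k (≤-<-trans k≤X X<L)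
    ... | no _ = inner w (<-≤-trans 0<k (m≤m+n k e)) (+-monoˡ-< e k<l′)

  prefix : ∀ {L X p} → Detour G a L p → X ≤ L → p X ≡ p L → Detour G a X p
  prefix w X≤L pX≡pL .steps k<X = steps w (<-≤-trans k<X X≤L)
  prefix w X≤L pX≡pL .first = first w
  prefix w X≤L pX≡pL .last = subst (Adj G a) (sym pX≡pL) (last w)
  prefix w X≤L pX≡pL .inner 0<k k<X = inner w 0<k (<-≤-trans k<X X≤L)

  module Cycle {L p} (w : Detour G a L p) where

    ChordAt RepeatAt : Set
    ChordAt = ∃₂ λ X Y → suc X < Y × Y ≤ L × Adj G (p X) (p Y)
    RepeatAt = ∃₂ λ X Y → X < Y × Y ≤ L × p X ≡ p Y

    end-or-inner : ∀ {k} → k ≤ L → k ≡ 0 ⊎ k ≡ L ⊎ (0 < k × k < L)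
    end-or-inner {zero} _ = inj₁ refl
    end-or-inner {suc k} k≤L with m≤n⇒m<n∨m≡n k≤L
    ... | inj₁ k<L = inj₂ (inj₂ (s≤s z≤n , k<L))
    ... | inj₂ k≡L = inj₂ (inj₁ k≡L)

    vertex≢a : ∀ {k} → k ≤ L → p k ≢ a
    vertex≢a k≤L with end-or-inner k≤L
    ... | inj₁ refl = ≢-sym (Adj⇒≢ (first w))
    ... | inj₂ (inj₁ refl) = ≢-sym (Adj⇒≢ (last w))
    ... | inj₂ (inj₂ (0<k , k<L)) = inner w 0<k k<L ∘ inj₁

    a-adjacent⇒end : ∀ {k} → k ≤ L → Adj G a (p k) → k ≡ 0 ⊎ k ≡ L
    a-adjacent⇒end k≤L ap with end-or-inner k≤L
    ... | inj₁ k≡0 = inj₁ k≡0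
    ... | inj₂ (inj₁ k≡L) = inj₂ k≡L
    ... | inj₂ (inj₂ (0<k , k<L)) = contradiction (inj₂ ap) (inner w 0<k k<L)

    vertex : ℕ → Fin n
    vertex = snoc L p a

    cycle : Fin (suc (suc L)) → Fin n
    cycle i = vertex (toℕ i)

    position : (i : Fin (suc (suc L))) → toℕ i ≤ L ⊎ toℕ i ≡ suc L
    position i with m≤n⇒m<n∨m≡n (≤-pred (toℕ<n i))
    ... | inj₁ i<1+L = inj₁ (≤-pred i<1+L)
    ... | inj₂ i≡1+L = inj₂ i≡1+L

    on-path : ∀ {m} → m ≤ L → vertex m ≡ p m
    on-path = snoc-≤ L p a

    apex : ∀ {m} → m ≡ suc L → vertex m ≡ a
    apex refl = snoc-suc L p a

    cycle-adjacent : ∀ i j → CycSucc (suc (suc L)) i j → Adj G (cycle i) (cycle j)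
    cycle-adjacent i j (inj₂ (i≡1+L , j≡0)) =
      subst₂ (Adj G) (sym (apex (suc-injective i≡1+L))) (sym (trans (cong vertex j≡0) (on-path z≤n))) (first w)
    cycle-adjacent i j (inj₁ 1+i≡j) with position i
    ... | inj₂ i≡1+L =
      contradiction (subst (_< suc (suc L)) (trans (sym 1+i≡j) (cong suc i≡1+L)) (toℕ<n j)) (<-irrefl refl)
    ... | inj₁ i≤L with m≤n⇒m<n∨m≡n i≤L
    ...   | inj₁ i<L = subst₂ (Adj G) (sym (on-path i≤L)) (sym (trans (cong vertex (sym 1+i≡j)) (on-path i<L)))
                         (steps w i<L)
    ...   | inj₂ i≡L = subst₂ (Adj G) (sym (trans (cong vertex i≡L) (on-path ≤-refl)))
                         (sym (apex (trans (sym 1+i≡j) (cong suc i≡L)))) (Adj-sym (last w))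

    repeat⇒RepeatAt : ∀ {i j} → i ≢ j → cycle i ≡ cycle j → RepeatAt
    repeat⇒RepeatAt {i} {j} i≢j eq with position i | position j
    ... | inj₁ i≤L | inj₁ j≤L with <-cmp (toℕ i) (toℕ j)
    ...   | tri< i<j _ _ = toℕ i , toℕ j , i<j , j≤L , trans (sym (on-path i≤L)) (trans eq (on-path j≤L))
    ...   | tri≈ _ i≡j _ = contradiction (toℕ-injective i≡j) i≢j
    ...   | tri> _ _ j<i = toℕ j , toℕ i , j<i , i≤L , trans (sym (on-path j≤L)) (trans (sym eq) (on-path i≤L))
    repeat⇒RepeatAt {i} {j} i≢j eq | inj₁ i≤L | inj₂ j≡1+L =
      contradiction (trans (sym (on-path i≤L)) (trans eq (apex j≡1+L))) (vertex≢a i≤L)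
    repeat⇒RepeatAt {i} {j} i≢j eq | inj₂ i≡1+L | inj₁ j≤L =
      contradiction (trans (sym (on-path j≤L)) (trans (sym eq) (apex i≡1+L))) (vertex≢a j≤L)
    repeat⇒RepeatAt {i} {j} i≢j eq | inj₂ i≡1+L | inj₂ j≡1+L =
      contradiction (toℕ-injective (trans i≡1+L (sym j≡1+L))) i≢j

    orient-chord : ∀ {X Y} → X ≤ L → Y ≤ L → Adj G (p X) (p Y) → suc X ≢ Y → suc Y ≢ X → ChordAt
    orient-chord {X} {Y} X≤L Y≤L adj 1+X≢Y 1+Y≢X with <-cmp X Y
    ... | tri< X<Y _ _ = X , Y , ≤∧≢⇒< X<Y 1+X≢Y , Y≤L , adj
    ... | tri≈ _ refl _ = contradiction refl (Adj⇒≢ adj)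
    ... | tri> _ _ Y<X = Y , X , ≤∧≢⇒< Y<X 1+Y≢X , X≤L , Adj-sym adj

    chord⇒ChordAt : ∀ {i j} → Adj G (cycle i) (cycle j)
                  → ¬ CycSucc (suc (suc L)) i j → ¬ CycSucc (suc (suc L)) j i → ChordAt
    chord⇒ChordAt {i} {j} adj ¬ij ¬ji with position i | position j
    ... | inj₁ i≤L | inj₁ j≤L =
      orient-chord i≤L j≤L (subst₂ (Adj G) (on-path i≤L) (on-path j≤L) adj) (¬ij ∘ inj₁) (¬ji ∘ inj₁)
    ... | inj₂ i≡1+L | inj₁ j≤L with a-adjacent⇒end j≤L (subst₂ (Adj G) (apex i≡1+L) (on-path j≤L) adj)
    ...   | inj₁ j≡0 = contradiction (inj₂ (cong suc i≡1+L , j≡0)) ¬ij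
    ...   | inj₂ j≡L = contradiction (inj₁ (trans (cong suc j≡L) (sym i≡1+L))) ¬ji
    chord⇒ChordAt {i} {j} adj ¬ij ¬ji | inj₁ i≤L | inj₂ j≡1+L
      with a-adjacent⇒end i≤L (Adj-sym (subst₂ (Adj G) (on-path i≤L) (apex j≡1+L) adj))
    ...   | inj₁ i≡0 = contradiction (inj₂ (cong suc j≡1+L , i≡0)) ¬ji
    ...   | inj₂ i≡L = contradiction (inj₁ (trans (cong suc i≡L) (sym j≡1+L))) ¬ij
    chord⇒ChordAt {i} {j} adj ¬ij ¬ji | inj₂ i≡1+L | inj₂ j≡1+L =
      contradiction (cong vertex (trans i≡1+L (sym j≡1+L))) (Adj⇒≢ adj)

    chord-or-repeat-at : 2 ≤ L → ChordAt ⊎ RepeatAt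
    chord-or-repeat-at 2≤L with chord-or-repeat G chordal cycle (s≤s (s≤s 2≤L)) cycle-adjacent
    ... | inj₁ (i , j , i≢j , eq) = inj₂ (repeat⇒RepeatAt i≢j eq)
    ... | inj₂ (i , j , adj , ¬ij , ¬ji) = inj₁ (chord⇒ChordAt adj ¬ij ¬ji)

  close-by-shortcut : ∀ {L p X e} → (∀ {l} → l < L → Closes l) → Detour G a L p
                    → e > 0 → suc X + e ≤ L → Adj G (p X) (p (suc X + e)) → p L ∈ N[ p 0 ]
  close-by-shortcut {L} {p} {X} {e} IH w e>0 Y≤L chord = close (shortcut w′ (m+n≤o⇒m≤o∸n (suc X) Y≤L) chord)
    where
    L≡l′+e : L ≡ (L ∸ e) + e
    L≡l′+e = sym (m∸n+n≡m (m+n≤o⇒n≤o (suc X) Y≤L))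
    w′ : Detour G a ((L ∸ e) + e) p
    w′ = subst (λ m → Detour G a m p) L≡l′+e w
    l′<L : L ∸ e < L
    l′<L = subst (L ∸ e <_) (sym L≡l′+e) (m<m+n (L ∸ e) e>0)
    close : (∃ λ q → Detour G a (L ∸ e) q × q 0 ≡ p 0 × q (L ∸ e) ≡ p ((L ∸ e) + e)) → p L ∈ N[ p 0 ]
    close (q , v , q₀ , qₗ) =
      subst₂ (λ x y → y ∈ N[ x ]) q₀ (trans qₗ (cong p (sym L≡l′+e))) (IH l′<L q v)

  close-by-chord : ∀ {L p X Y} → (∀ {l} → l < L → Closes l) → Detour G a L p
                 → suc X < Y → Y ≤ L → Adj G (p X) (p Y) → p L ∈ N[ p 0 ]
  close-by-chord {X = X} IH w 1+X<Y Y≤L chord with m≤n⇒∃[o]m+o≡n (<⇒≤ 1+X<Y)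
  ... | e , refl =
    close-by-shortcut IH w (n≢0⇒n>0 λ { refl → <-irrefl (sym (+-identityʳ (suc X))) 1+X<Y }) Y≤L chord

  -- Through a, a detour closes into a cycle.  A chord or repeated vertex of that cycle
  -- shortens the detour; without them the cycle is induced, so it must be a triangle.
  detour-closes : ∀ {L} → Acc _<_ L → Closes L
  detour-closes {zero} _ p w = inj₁ refl
  detour-closes {suc zero} _ p w = inj₂ (steps w (s≤s z≤n))
  detour-closes {L@(suc (suc _))} (acc shorter) p w with Cycle.chord-or-repeat-at w (s≤s (s≤s z≤n))
  ... | inj₁ (X , Y , 1+X<Y , Y≤L , chord) = close-by-chord (detour-closes ∘ shorter) w 1+X<Y Y≤L chord
  ... | inj₂ (X , Y , X<Y , Y≤L , pX≡pY) with m≤n⇒m<n∨m≡n Y≤L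
  ...   | inj₁ Y<L = close-by-chord (detour-closes ∘ shorter) w (s≤s X<Y) Y<L
                       (subst (λ v → Adj G v (p (suc Y))) (sym pX≡pY) (steps w Y<L))
  ...   | inj₂ refl = subst (_∈ N[ p 0 ]) pX≡pY (detour-closes (shorter X<Y) p (prefix w (<⇒≤ X<Y) pX≡pY))

module Separator (G : SimpleGraph n) (chordal : Chordal G) where
  open GraphNotions G
  open Reachability G

  module _ {U : DecSubset n} {a b : Fin n} (C : Component G (U ∖ N[ a ]) b) where
    open Component C

    boundary⊆N : ∀ {z} → z ∈ boundary U members → Adj G a z
    boundary⊆N {z} (z∈U , z∉C , c , c∈C , zc) with z ∈? N[ a ]
    ... | yes (inj₁ refl) = contradiction (inj₂ zc) (proj₂ (⊆P c∈C))
    ... | yes (inj₂ az) = az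
    ... | no z∉N = contradiction (closed c∈C (z∈U , z∉N) (Adj-sym zc)) z∉C

    boundary-clique : IsClique (boundary U members)
    boundary-clique {s} {t} s∈∂@(_ , _ , c₁ , c₁∈C , sc₁) t∈∂@(_ , _ , c₂ , c₂∈C , tc₂) s≢t
      = endpoints-adjacent (DetourLemma.detour-closes G chordal a (<-wellFounded _) p detour)
      where
      open Walk (reach⇒walk G (reach-trans (reach-sym (connected c₁∈C)) (connected c₂∈C)))
      m = length
      p = snoc (suc m) (s ◁ vertex) t
      p≡ : ∀ {k} → k ≤ suc m → p k ≡ (s ◁ vertex) k
      p≡ = snoc-≤ (suc m) (s ◁ vertex) t
      detour : Detour G a (suc (suc m)) p
      detour .Detour.steps {zero} _ = subst₂ (Adj G) (sym (p≡ z≤n)) (sym (trans (p≡ (s≤s z≤n)) start)) sc₁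
      detour .Detour.steps {suc k} k<L with m≤n⇒m<n∨m≡n (≤-pred (≤-pred k<L))
      ... | inj₁ k<m = subst₂ (Adj G) (sym (p≡ (<⇒≤ (s≤s k<m)))) (sym (p≡ (s≤s k<m))) (steps k<m)
      ... | inj₂ refl =
        subst₂ (Adj G) (sym (trans (p≡ ≤-refl) end)) (sym (snoc-suc (suc m) (s ◁ vertex) t)) (Adj-sym tc₂)
      detour .Detour.first = subst (Adj G a) (sym (p≡ z≤n)) (boundary⊆N s∈∂)
      detour .Detour.last = subst (Adj G a) (sym (snoc-suc (suc m) (s ◁ vertex) t)) (boundary⊆N t∈∂)
      detour .Detour.inner {suc k} _ k<L =
        subst (_∉ N[ a ]) (sym (p≡ (≤-pred k<L))) (proj₂ (⊆P (inside (≤-pred (≤-pred k<L)))))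
      endpoints-adjacent : p (suc (suc m)) ∈ N[ p 0 ] → Adj G s t
      endpoints-adjacent pL∈N[p₀]
        with subst₂ (λ x y → y ∈ N[ x ]) (p≡ z≤n) (snoc-suc (suc m) (s ◁ vertex) t) pL∈N[p₀]
      ... | inj₁ t≡s = contradiction (sym t≡s) s≢t
      ... | inj₂ st = st

module Dirac (G : SimpleGraph n) (chordal : Chordal G) where
  open GraphNotions G
  open Separator G chordal

  DiracProperty : DecSubset n → Set
  DiracProperty U = IsClique U ⊎ ∃₂ λ x y → IsSimplicial U x × IsSimplicial U y × x ≢ y × ¬ Adj G x y

  simplicial-inside : ∀ {U C c₀} → C ⊆ U → c₀ ∈ C → IsClique (boundary U C)
                    → DiracProperty (C ∪ boundary U C) → ∃ λ x → x ∈ C × IsSimplicial U x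
  simplicial-inside {U} {C} {c₀} C⊆U c₀∈C ∂-clique = pick
    where
    W = C ∪ boundary U C
    neighbour∈W : ∀ {x y} → x ∈ C → y ∈ U → Adj G x y → y ∈ W
    neighbour∈W {x} {y} x∈C y∈U xy with y ∈? C
    ... | yes y∈C = inj₁ y∈C
    ... | no y∉C = inj₂ (y∈U , y∉C , x , x∈C , Adj-sym xy)
    lift : ∀ {x} → x ∈ C → IsSimplicial W x → IsSimplicial U x
    lift x∈C (_ , simplicial) = C⊆U x∈C , λ y∈U z∈U xy xz →
      simplicial (neighbour∈W x∈C y∈U xy) (neighbour∈W x∈C z∈U xz) xy xz
    pick : DiracProperty W → ∃ λ x → x ∈ C × IsSimplicial U x
    pick (inj₁ W-clique) = c₀ , c₀∈C , lift c₀∈C (inj₁ c₀∈C , λ y∈W z∈W _ _ → W-clique y∈W z∈W)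
    pick (inj₂ (x , y , x-simp@(inj₁ x∈C , _) , _ , _)) = x , x∈C , lift x∈C x-simp
    pick (inj₂ (x , y , (inj₂ _ , _) , y-simp@(inj₁ y∈C , _) , _)) = y , y∈C , lift y∈C y-simp
    pick (inj₂ (x , y , (inj₂ x∈∂ , _) , (inj₂ y∈∂ , _) , x≢y , ¬xy)) =
      contradiction (∂-clique x∈∂ y∈∂ x≢y) ¬xy

  outer-boundary : ∀ {U V a} (D : Component G (U ∖ (V ∪ boundary U V)) a)
                 → boundary U (Component.members D) ⊆ boundary U V
  outer-boundary {U} {V} D {z} (z∈U , z∉D , d , d∈D , zd) with z ∈? V ∪ boundary U V | Component.⊆P D d∈D
  ... | no z∉W | _ = contradiction (Component.closed D d∈D (z∈U , z∉W) (Adj-sym zd)) z∉D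
  ... | yes (inj₂ z∈∂V) | _ = z∈∂V
  ... | yes (inj₁ z∈V) | d∈U , d∉W =
    contradiction (inj₂ (d∈U , d∉W ∘ inj₁ , z , z∈V , Adj-sym zd)) d∉W

  module Step {U : DecSubset n} (IH : ∀ V → ∣ V ∣ < ∣ U ∣ → DiracProperty V)
              {a b} (a∈U : a ∈ U) (b∈U : b ∈ U) (a≢b : a ≢ b) (¬ab : ¬ Adj G a b) where

    K₁ : Component G (U ∖ N[ a ]) b
    K₁ = component G (b∈U , [ a≢b ∘ sym , ¬ab ])
    C₁ = Component.members K₁
    W₁ = C₁ ∪ boundary U C₁

    W₁⊆U : W₁ ⊆ U
    W₁⊆U (inj₁ x∈C₁) = proj₁ (Component.⊆P K₁ x∈C₁)
    W₁⊆U (inj₂ x∈∂) = proj₁ x∈∂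

    ∂₁-clique : IsClique (boundary U C₁)
    ∂₁-clique = boundary-clique {U} {a} {b} K₁

    a∉W₁ : a ∉ W₁
    a∉W₁ (inj₁ a∈C₁) = proj₂ (Component.⊆P K₁ a∈C₁) (inj₁ refl)
    a∉W₁ (inj₂ a∈∂) = Adj⇒≢ (boundary⊆N {U} {a} {b} K₁ a∈∂) refl

    K₂ : Component G (U ∖ W₁) a
    K₂ = component G (a∈U , a∉W₁)
    C₂ = Component.members K₂
    W₂ = C₂ ∪ boundary U C₂

    ∂₂⊆∂₁ : boundary U C₂ ⊆ boundary U C₁
    ∂₂⊆∂₁ = outer-boundary {U} {C₁} {a} K₂

    W₂⊆U : W₂ ⊆ U
    W₂⊆U (inj₁ x∈C₂) = proj₁ (Component.⊆P K₂ x∈C₂)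
    W₂⊆U (inj₂ x∈∂) = proj₁ x∈∂

    b∉W₂ : b ∉ W₂
    b∉W₂ (inj₁ b∈C₂) = proj₂ (Component.⊆P K₂ b∈C₂) (inj₁ (Component.b∈ K₁))
    b∉W₂ (inj₂ b∈∂) = proj₁ (proj₂ (∂₂⊆∂₁ b∈∂)) (Component.b∈ K₁)

    simplicial-in-C₁ : ∃ λ x → x ∈ C₁ × IsSimplicial U x
    simplicial-in-C₁ = simplicial-inside {U} {C₁} (W₁⊆U ∘ inj₁) (Component.b∈ K₁) ∂₁-clique
                  (IH W₁ (p⊂q⇒∣p∣<∣q∣ W₁ U W₁⊆U a∈U a∉W₁))

    simplicial-in-C₂ : ∃ λ x → x ∈ C₂ × IsSimplicial U x
    simplicial-in-C₂ = simplicial-inside {U} {C₂} (W₂⊆U ∘ inj₁) (Component.b∈ K₂)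
                         (λ s t → ∂₁-clique (∂₂⊆∂₁ s) (∂₂⊆∂₁ t))
                  (IH W₂ (p⊂q⇒∣p∣<∣q∣ W₂ U W₂⊆U b∈U b∉W₂))

    two-simplicial : ∃₂ λ x y → IsSimplicial U x × IsSimplicial U y × x ≢ y × ¬ Adj G x y
    two-simplicial = apart simplicial-in-C₁ simplicial-in-C₂
      where
      apart : (∃ λ x → x ∈ C₁ × IsSimplicial U x) → (∃ λ x → x ∈ C₂ × IsSimplicial U x)
               → ∃₂ λ x y → IsSimplicial U x × IsSimplicial U y × x ≢ y × ¬ Adj G x y
      apart (x₁ , x₁∈C₁ , x₁-simp) (x₂ , x₂∈C₂ , x₂-simp) =
        x₁ , x₂ , x₁-simp , x₂-simp , x₁≢x₂ , ¬x₁x₂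
        where
        x₂∉W₁ : x₂ ∉ W₁
        x₂∉W₁ = proj₂ (Component.⊆P K₂ x₂∈C₂)
        x₁≢x₂ : x₁ ≢ x₂
        x₁≢x₂ refl = x₂∉W₁ (inj₁ x₁∈C₁)
        ¬x₁x₂ : ¬ Adj G x₁ x₂
        ¬x₁x₂ x₁x₂ = x₂∉W₁ (inj₂ (proj₁ x₂-simp , x₂∉W₁ ∘ inj₁ , x₁ , x₁∈C₁ , Adj-sym x₁x₂))

  dirac : ∀ U → Acc _<_ ∣ U ∣ → DiracProperty U
  dirac U (acc smaller)
    with any? (λ a → any? (λ b → a ∈? U ×-dec b ∈? U ×-dec ¬? (a ≟ b) ×-dec ¬? (Adj? a b)))
  ... | yes (a , b , a∈U , b∈U , a≢b , ¬ab) =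
    inj₂ (Step.two-simplicial (λ V V<U → dirac V (smaller V<U)) a∈U b∈U a≢b ¬ab)
  ... | no noPair = inj₁ λ {u} {w} u∈U w∈U u≢w →
    decidable-stable (Adj? u w) (λ ¬uw → noPair (u , w , u∈U , w∈U , u≢w , ¬uw))

  simplicial-vertex : ∀ {U v} → v ∈ U → ∃ (IsSimplicial U)
  simplicial-vertex {U} {v} v∈U with dirac U (<-wellFounded _)
  ... | inj₁ U-clique = v , v∈U , λ x∈U y∈U _ _ → U-clique x∈U y∈U
  ... | inj₂ (x , _ , x-simp , _) = x , x-simp

record ParentTree (m : ℕ) : Set where
  field
    root         : Fin m
    parent       : Fin m → Fin m
    depth        : Fin m → ℕ
    depth-parent : ∀ {x} → x ≢ root → depth (parent x) < depth x

module ParentTreeGraph {m} (T : ParentTree m) where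
  open ParentTree T

  ChildOf : Fin m → Fin m → Set
  ChildOf x y = x ≢ root × parent x ≡ y

  Edge : Fin m → Fin m → Set
  Edge x y = ChildOf x y ⊎ ChildOf y x

  edge? : ∀ x y → Dec (Edge x y)
  edge? x y = (¬? (x ≟ root) ×-dec parent x ≟ y) ⊎-dec (¬? (y ≟ root) ×-dec parent y ≟ x)

  ¬ChildOf-self : ∀ {x} → ¬ ChildOf x x
  ¬ChildOf-self (x≢root , px≡x) = <-irrefl (cong depth px≡x) (depth-parent x≢root)

  graph : SimpleGraph m
  graph = record
    { adj    = λ x y → does (edge? x y)
    ; sym    = λ x y → does-⇔ (mk⇔ swap swap) (edge? x y) (edge? y x)
    ; irrefl = λ x → dec-false (edge? x x) [ ¬ChildOf-self , ¬ChildOf-self ] }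

  open GraphNotions graph using (Adj-sym)
  open Reachability graph

  parent-adjacent : ∀ {x} → x ≢ root → Adj graph (parent x) x
  parent-adjacent {x} x≢root = dec-true (edge? (parent x) x) (inj₂ (x≢root , refl))

  module _ {P : Pred (Fin m) 0ℓ} {t} (upward : ∀ {x} → P x → x ≢ t → x ≢ root × P (parent x)) where

    reach-from-top : ∀ {x} → Acc _<_ (depth x) → P x → ReachIn graph P t x
    reach-from-top {x} (acc shallower) Px with x ≟ t
    ... | yes refl = here Px
    ... | no x≢t = step (reach-from-top (shallower (depth-parent x≢root)) Ppx) (parent-adjacent x≢root) Px
      where
      x≢root = proj₁ (upward Px x≢t)
      Ppx = proj₂ (upward Px x≢t)

    upward-closed-connected : ∀ {x y} → P x → P y → ReachIn graph P x y
    upward-closed-connected Px Py =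
      reach-trans (reach-sym (reach-from-top (<-wellFounded _) Px)) (reach-from-top (<-wellFounded _) Py)

  acyclic : ∀ k (c : Fin k → Fin m) → ¬ IsCycle graph k c
  acyclic (suc k) c (3≤k , c-injective , cycle) =
    cycSucc²-≢ 3≤k hi ij (c-injective (trans (sym (parent-of-deepest (Adj-sym {c h} {c i} (cycle h i hi))))
                                              (parent-of-deepest (cycle i j ij))))
    where
    i = argmax (depth ∘ c) fzero (allFin _)
    deepest : ∀ j → depth (c j) ≤ depth (c i)
    deepest j = All.lookup (f[xs]≤f[argmax] {f = depth ∘ c} fzero (allFin _)) (∈-allFin j)
    h = proj₁ (cycPred-exists i)
    hi = proj₂ (cycPred-exists i)
    j = proj₁ (cycSucc-exists i)
    ij = proj₂ (cycSucc-exists i)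
    parent-of-deepest : ∀ {j} → Adj graph (c i) (c j) → parent (c i) ≡ c j
    parent-of-deepest {j} adj with dec-true⁻ (edge? (c i) (c j)) adj
    ... | inj₁ (_ , pcᵢ≡cⱼ) = pcᵢ≡cⱼ
    ... | inj₂ (cⱼ≢root , pcⱼ≡cᵢ) =
      contradiction (deepest j) (<⇒≱ (subst (λ v → depth v < depth (c j)) pcⱼ≡cᵢ (depth-parent cⱼ≢root)))

  isTree : IsTree graph
  isTree = >-nonZero⁻¹ m {{nonZeroIndex root}}
         , (λ u v → upward-closed-connected {P = λ _ → ⊤} {t = root} (λ _ x≢root → x≢root , tt) tt tt)
         , acyclic

attach : ∀ {m} → ParentTree m → Fin m → ParentTree (suc m)
attach T h = record
  { root         = fsuc root
  ; parent       = λ { fzero → fsuc h ; (fsuc x) → fsuc (parent x) }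
  ; depth        = λ { fzero → suc (depth h) ; (fsuc x) → depth x }
  ; depth-parent = λ { {fzero} _ → ≤-refl ; {fsuc x} x≢root → depth-parent (x≢root ∘ cong fsuc) } }
  where open ParentTree T

module _ (G : SimpleGraph n) where
  open GraphNotions G

  record SubtreeModel (U : DecSubset n) : Set₁ where
    field
      size : ℕ
      tree : ParentTree size
      S    : Fin n → DecSubset size
      X    : DecSubset size
      top  : Fin n → Fin size
    open ParentTree tree
    field
      top∈S      : ∀ {v} → v ∈ U → top v ∈ S v
      upward     : ∀ {v x} → v ∈ U → x ∈ S v → x ≢ top v → x ≢ root × parent x ∈ S v
      empty      : ∀ {v x} → v ∉ U → x ∉ S v
      hit        : ∀ {v} → v ∈ U → ∃ λ x → x ∈ X × x ∈ S v
      hit-unique : ∀ {v x y} → v ∈ U → x ∈ X → x ∈ S v → y ∈ X → y ∈ S v → x ≡ y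
      adj⇒meet   : ∀ {u v} → u ∈ U → v ∈ U → Adj G u v → ∃ λ x → x ∈ S u × x ∈ S v
      meet⇒adj   : ∀ {u v x} → u ∈ U → v ∈ U → u ≢ v → x ∈ S u → x ∈ S v → Adj G u v
      -- Carried as an invariant instead of being proved for subtrees in general:
      -- it provides the node below which the next simplicial vertex is attached.
      helly      : ∀ {K} → K ⊆ U → IsClique K → ∃ λ x → ∀ {u} → u ∈ K → x ∈ S u

  emptyModel : ∀ {U} → (∀ {v} → v ∉ U) → SubtreeModel U
  emptyModel U-empty = record
    { size = 1
    ; tree = record
        { root = fzero ; parent = λ x → x ; depth = λ _ → 0
        ; depth-parent = λ { {fzero} 0≢0 → contradiction refl 0≢0 } }
    ; S = λ _ → ∅ ; X = ∅ ; top = λ _ → fzero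
    ; top∈S = λ v∈U → contradiction v∈U U-empty
    ; upward = λ v∈U → contradiction v∈U U-empty
    ; empty = λ _ ()
    ; hit = λ v∈U → contradiction v∈U U-empty
    ; hit-unique = λ v∈U → contradiction v∈U U-empty
    ; adj⇒meet = λ u∈U → contradiction u∈U U-empty
    ; meet⇒adj = λ u∈U → contradiction u∈U U-empty
    ; helly = λ K⊆U _ → fzero , λ u∈K → contradiction (K⊆U u∈K) U-empty }

  module Extend {U : DecSubset n} {v} (v-simp : IsSimplicial U v) (M : SubtreeModel (U ∖ ｛ v ｝)) where
    open SubtreeModel M
    open ParentTree tree

    U′ = U ∖ ｛ v ｝

    v∉U′ : v ∉ U′
    v∉U′ (_ , v≢v) = v≢v refl

    Nv : DecSubset n
    Nv = record { Member = λ u → u ∈ U′ × Adj G v u ; member? = λ u → u ∈? U′ ×-dec Adj? v u }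

    Nv-clique : IsClique Nv
    Nv-clique (u∈U′ , vu) (w∈U′ , vw) = proj₂ v-simp (proj₁ u∈U′) (proj₁ w∈U′) vu vw

    hub : Fin size
    hub = proj₁ (helly {Nv} proj₁ Nv-clique)

    hub∈S : ∀ {u} → u ∈ Nv → hub ∈ S u
    hub∈S = proj₂ (helly {Nv} proj₁ Nv-clique)

    tree′ : ParentTree (suc (suc size))
    tree′ = attach (attach tree hub) fzero

    old-member : ∀ {u x} → u ∈ U → x ∈ S u → u ∈ U′
    old-member {u} u∈U x∈S with u ≟ v
    ... | yes refl = contradiction x∈S (empty v∉U′)
    ... | no u≢v = u∈U , u≢v

    -- Node fsuc fzero hangs below the hub and is shared by v and its neighbours, whose
    -- subtrees are already hit, so it stays out of X′; v is hit at its private leaf fzero.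
    S′ : Fin n → DecSubset (suc (suc size))
    S′ u = record
      { Member  = λ { fzero → u ≡ v ; (fsuc fzero) → u ≡ v ⊎ u ∈ Nv ; (fsuc (fsuc x)) → x ∈ S u }
      ; member? = λ { fzero → u ≟ v ; (fsuc fzero) → u ≟ v ⊎-dec u ∈? Nv ; (fsuc (fsuc x)) → x ∈? S u } }

    X′ : DecSubset (suc (suc size))
    X′ = record
      { Member  = λ { fzero → ⊤ ; (fsuc fzero) → ⊥ ; (fsuc (fsuc x)) → x ∈ X }
      ; member? = λ { fzero → yes tt ; (fsuc fzero) → no λ () ; (fsuc (fsuc x)) → x ∈? X } }

    top′ : Fin n → Fin (suc (suc size))
    top′ u with u ≟ v
    ... | yes _ = fsuc fzero
    ... | no _ = fsuc (fsuc (top u))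

    top′∈S′ : ∀ {u} → u ∈ U → top′ u ∈ S′ u
    top′∈S′ {u} u∈U with u ≟ v
    ... | yes u≡v = inj₁ u≡v
    ... | no u≢v = top∈S (u∈U , u≢v)

    upward′ : ∀ {u x} → u ∈ U → x ∈ S′ u → x ≢ top′ u
            → x ≢ ParentTree.root tree′ × ParentTree.parent tree′ x ∈ S′ u
    upward′ {u} {fzero} u∈U u≡v _ = (λ ()) , inj₁ u≡v
    upward′ {u} {fsuc fzero} u∈U x∈S′ x≢top′ with u ≟ v | x∈S′
    ... | yes _ | _ = contradiction refl x≢top′
    ... | no u≢v | inj₁ u≡v = contradiction u≡v u≢v
    ... | no _ | inj₂ u∈Nv = (λ ()) , hub∈S u∈Nv
    upward′ {u} {fsuc (fsuc x)} u∈U x∈S x≢top′ with u ≟ v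
    ... | yes refl = contradiction x∈S (empty v∉U′)
    ... | no u≢v = (λ { refl → x≢root refl }) , px∈S
      where
      x≢root = proj₁ (upward (u∈U , u≢v) x∈S (x≢top′ ∘ cong (fsuc ∘ fsuc)))
      px∈S = proj₂ (upward (u∈U , u≢v) x∈S (x≢top′ ∘ cong (fsuc ∘ fsuc)))

    empty′ : ∀ {u x} → u ∉ U → x ∉ S′ u
    empty′ {u} {fzero} u∉U refl = u∉U (proj₁ v-simp)
    empty′ {u} {fsuc fzero} u∉U (inj₁ refl) = u∉U (proj₁ v-simp)
    empty′ {u} {fsuc fzero} u∉U (inj₂ ((u∈U , _) , _)) = u∉U u∈U
    empty′ {u} {fsuc (fsuc x)} u∉U = empty (u∉U ∘ proj₁)

    hit′ : ∀ {u} → u ∈ U → ∃ λ x → x ∈ X′ × x ∈ S′ u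
    hit′ {u} u∈U with u ≟ v
    ... | yes u≡v = fzero , tt , u≡v
    ... | no u≢v with hit (u∈U , u≢v)
    ...   | x , x∈X , x∈S = fsuc (fsuc x) , x∈X , x∈S

    hit-unique′ : ∀ {u x y} → u ∈ U → x ∈ X′ → x ∈ S′ u → y ∈ X′ → y ∈ S′ u → x ≡ y
    hit-unique′ {x = fzero} {fzero} _ _ _ _ _ = refl
    hit-unique′ {x = fzero} {fsuc (fsuc y)} u∈U _ refl _ y∈S = contradiction y∈S (empty v∉U′)
    hit-unique′ {x = fsuc (fsuc x)} {fzero} u∈U _ x∈S _ refl = contradiction x∈S (empty v∉U′)
    hit-unique′ {x = fsuc (fsuc x)} {fsuc (fsuc y)} u∈U x∈X x∈S y∈X y∈S =
      cong (fsuc ∘ fsuc) (hit-unique (old-member u∈U x∈S) x∈X x∈S y∈X y∈S)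

    adj⇒meet′ : ∀ {u w} → u ∈ U → w ∈ U → Adj G u w → ∃ λ x → x ∈ S′ u × x ∈ S′ w
    adj⇒meet′ {u} {w} u∈U w∈U uw with u ≟ v | w ≟ v
    ... | yes refl | yes refl = contradiction refl (Adj⇒≢ uw)
    ... | yes refl | no w≢v = fsuc fzero , inj₁ refl , inj₂ ((w∈U , w≢v) , uw)
    ... | no u≢v | yes refl = fsuc fzero , inj₂ ((u∈U , u≢v) , Adj-sym uw) , inj₁ refl
    ... | no u≢v | no w≢v with adj⇒meet (u∈U , u≢v) (w∈U , w≢v) uw
    ...   | x , x∈Su , x∈Sw = fsuc (fsuc x) , x∈Su , x∈Sw

    meet⇒adj′ : ∀ {u w x} → u ∈ U → w ∈ U → u ≢ w → x ∈ S′ u → x ∈ S′ w → Adj G u w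
    meet⇒adj′ {x = fzero} _ _ u≢w refl refl = contradiction refl u≢w
    meet⇒adj′ {x = fsuc fzero} _ _ u≢w (inj₁ refl) (inj₁ refl) = contradiction refl u≢w
    meet⇒adj′ {x = fsuc fzero} _ _ u≢w (inj₁ refl) (inj₂ (_ , vw)) = vw
    meet⇒adj′ {x = fsuc fzero} _ _ u≢w (inj₂ (_ , vu)) (inj₁ refl) = Adj-sym vu
    meet⇒adj′ {x = fsuc fzero} _ _ u≢w (inj₂ u∈Nv) (inj₂ w∈Nv) = Nv-clique u∈Nv w∈Nv u≢w
    meet⇒adj′ {x = fsuc (fsuc x)} u∈U w∈U u≢w x∈Su x∈Sw =
      meet⇒adj (old-member u∈U x∈Su) (old-member w∈U x∈Sw) u≢w x∈Su x∈Sw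

    helly′ : ∀ {K} → K ⊆ U → IsClique K → ∃ λ x → ∀ {u} → u ∈ K → x ∈ S′ u
    helly′ {K} K⊆U K-clique with v ∈? K
    ... | yes v∈K = fsuc fzero , shared
      where
      shared : ∀ {u} → u ∈ K → u ≡ v ⊎ u ∈ Nv
      shared {u} u∈K with u ≟ v
      ... | yes u≡v = inj₁ u≡v
      ... | no u≢v = inj₂ ((K⊆U u∈K , u≢v) , K-clique v∈K u∈K (u≢v ∘ sym))
    ... | no v∉K with helly {K} (λ u∈K → K⊆U u∈K , λ { refl → v∉K u∈K }) K-clique
    ...   | x , x∈S = fsuc (fsuc x) , x∈S

    model : SubtreeModel U
    model = record
      { size = suc (suc size) ; tree = tree′ ; S = S′ ; X = X′ ; top = top′
      ; top∈S = top′∈S′ ; upward = upward′ ; empty = λ {u} {x} → empty′ {u} {x}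
      ; hit = hit′ ; hit-unique = hit-unique′ ; adj⇒meet = adj⇒meet′
      ; meet⇒adj = λ {u} {w} {x} → meet⇒adj′ {u} {w} {x} ; helly = λ {K} → helly′ {K} }

module Construction (G : SimpleGraph n) (chordal : Chordal G) where
  open GraphNotions G

  build : ∀ U → Acc _<_ ∣ U ∣ → SubtreeModel G U
  build U (acc smaller) with any? (_∈? U)
  ... | no noVertex = emptyModel G λ {v} v∈U → noVertex (v , v∈U)
  ... | yes (u , u∈U) with Dirac.simplicial-vertex G chordal {U} u∈U
  ...   | v , v-simp = Extend.model G {U} {v} v-simp (build (U ∖ ｛ v ｝) (smaller U′<U))
    where
    U′<U : ∣ U ∖ ｛ v ｝ ∣ < ∣ U ∣
    U′<U = p⊂q⇒∣p∣<∣q∣ (U ∖ ｛ v ｝) U proj₁ (proj₁ v-simp) λ (_ , v≢v) → v≢v refl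

  everything : DecSubset n
  everything = record { Member = λ _ → ⊤ ; member? = λ _ → yes tt }

  subtreeRep : HasExactlyHittableSubtreeRep G
  subtreeRep = size , graph , Sᵇ , isTree , subtree , intersection , Xᵇ , hitting
    where
    open SubtreeModel (build everything (<-wellFounded _))
    open ParentTree tree
    open ParentTreeGraph tree
    Sᵇ : Fin n → Fin size → Bool
    Sᵇ v x = does (x ∈? S v)
    Xᵇ : Fin size → Bool
    Xᵇ x = does (x ∈? X)
    ∈Sᵇ⁺ : ∀ {v x} → x ∈ S v → x ∈ₛ Sᵇ v
    ∈Sᵇ⁺ {v} {x} = dec-true (x ∈? S v)
    ∈Sᵇ⁻ : ∀ {v x} → x ∈ₛ Sᵇ v → x ∈ S v
    ∈Sᵇ⁻ {v} {x} = dec-true⁻ (x ∈? S v)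
    subtree : ∀ v → IsSubtree graph (Sᵇ v)
    subtree v = (top v , ∈Sᵇ⁺ (top∈S tt)) , λ x y → upward-closed-connected {t = top v} upwardᵇ
      where
      upwardᵇ : ∀ {x} → x ∈ₛ Sᵇ v → x ≢ top v → x ≢ root × parent x ∈ₛ Sᵇ v
      upwardᵇ x∈S x≢top = map₂ ∈Sᵇ⁺ (upward tt (∈Sᵇ⁻ x∈S) x≢top)
    intersection : IsIntersectionGraphOf G Sᵇ
    intersection u v u≢v =
      meet , λ (x , x∈Su , x∈Sv) → meet⇒adj tt tt u≢v (∈Sᵇ⁻ x∈Su) (∈Sᵇ⁻ x∈Sv)
      where
      meet : Adj G u v → ∃ λ x → x ∈ₛ Sᵇ u × x ∈ₛ Sᵇ v
      meet uv with adj⇒meet tt tt uv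
      ... | x , x∈Su , x∈Sv = x , ∈Sᵇ⁺ x∈Su , ∈Sᵇ⁺ x∈Sv
    hitting : ∀ v → (∃ λ x → x ∈ₛ Xᵇ × x ∈ₛ Sᵇ v)
                  × (∀ x y → x ∈ₛ Xᵇ → x ∈ₛ Sᵇ v → y ∈ₛ Xᵇ → y ∈ₛ Sᵇ v → x ≡ y)
    hitting v = (x , dec-true (x ∈? X) x∈X , ∈Sᵇ⁺ x∈S)
              , λ x y x∈X x∈S y∈X y∈S → hit-unique tt (dec-true⁻ (x ∈? X) x∈X) (∈Sᵇ⁻ x∈S)
                                                      (dec-true⁻ (y ∈? X) y∈X) (∈Sᵇ⁻ y∈S)
      where
      x = proj₁ (hit {v} tt)
      x∈X = proj₁ (proj₂ (hit {v} tt))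
      x∈S = proj₂ (proj₂ (hit {v} tt))

mainTheorem4 : ((n : ℕ) (G : SimpleGraph n) → HasExactlyHittableHypergraphRep G)
    × ((n : ℕ) (G : SimpleGraph n) → Connected G → Chordal G → HasExactlyHittableSubtreeRep G)
mainTheorem4 = (λ n G → IncidenceHypergraph.hypergraphRep G)
             , (λ n G _ chordal → Construction.subtreeRep G chordal)
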